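{- Let $d \ge 2$ be an integer, and define polynomials $r_n, s_n \in \mathbb{Z}[b]$ by $r_0 = s_0 = 1$ and, for $n \ge 0$, \[ r_{n+1} = (b+1)\,d\, r_n s_n^{d-1}, \qquad s_{n+1} = r_n^d + (d-1) s_n^d. \] For $m \ge 1$ set $\sigma_m = (b+1)d\, s_{m-1}^d$, $\tau_m = s_m - \sigma_m$, and \[ \mathcal{G}_m = \frac{1}{bd}\left[(b+1)^d d^d s_{m-1}^{d(d-1)} - (bd+1)\,\frac{s_m^d - \bigl((b+1)d\, s_{m-1}^d\bigr)^d}{s_m - (b+1)d\, s_{m-1}^d}\right]. \] Then for every $m \ge 2$, \[ \frac{\tau_m}{\tau_{m-1}} = bd\,\mathcal{G}_{m-1}, \] and for every $m \ge 1$, \[ \tau_m = -(bd)^m\, \mathcal{G}_{m-1} \mathcal{G}_{m-2} \cdots \mathcal{G}_1 \] (the empty product being $1$ when $m = 1$). -}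

module Defs where

open import Data.Nat using (ℕ; zero; suc; _∸_; _^_) renaming (_*_ to _*ℕ_)
open import Data.Integer using (ℤ; +_; -_; _+_; _*_)
open import Data.List using (List; []; _∷_; map)
open import Data.List.Relation.Unary.All using (All)
open import Data.Product using (_×_; _,_; proj₁; proj₂)
open import Relation.Binary.PropositionalEquality using (_≡_)

-- The polynomial ring ℤ[b]: a polynomial is its list of integer
-- coefficients, lowest degree first (trailing zeros allowed).
Poly : Set
Poly = List ℤ

infixl 6 _⊕_
infixl 7 _⊗_
infix 4 _≈_

_⊕_ : Poly → Poly → Poly
[] ⊕ q = q
(a ∷ p) ⊕ [] = a ∷ p
(a ∷ p) ⊕ (c ∷ q) = (a + c) ∷ (p ⊕ q)

scale : ℤ → Poly → Poly
scale c p = map (c *_) p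

_⊗_ : Poly → Poly → Poly
[] ⊗ q = []
(a ∷ p) ⊗ q = scale a q ⊕ (+ 0 ∷ (p ⊗ q))

neg : Poly → Poly
neg p = map -_ p

κ : ℤ → Poly
κ c = c ∷ []

𝟘 : Poly
𝟘 = []

𝟙 : Poly
𝟙 = κ (+ 1)

pow : Poly → ℕ → Poly
pow p zero = 𝟙
pow p (suc k) = p ⊗ pow p k

_≈_ : Poly → Poly → Set
p ≈ q = All (_≡ + 0) (p ⊕ neg q)

b+1 : Poly
b+1 = + 1 ∷ + 1 ∷ []

bd : ℕ → Poly
bd d = + 0 ∷ + d ∷ []

bd+1 : ℕ → Poly
bd+1 d = + 1 ∷ + d ∷ []

rs : ℕ → ℕ → Poly × Poly
rs d zero = 𝟙 , 𝟙
rs d (suc n) =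
  (b+1 ⊗ κ (+ d) ⊗ proj₁ (rs d n) ⊗ pow (proj₂ (rs d n)) (d ∸ 1)) ,
  (pow (proj₁ (rs d n)) d ⊕ κ (+ (d ∸ 1)) ⊗ pow (proj₂ (rs d n)) d)

r : ℕ → ℕ → Poly
r d n = proj₁ (rs d n)

s : ℕ → ℕ → Poly
s d n = proj₂ (rs d n)

σ : ℕ → ℕ → Poly
σ d m = b+1 ⊗ κ (+ d) ⊗ pow (s d (m ∸ 1)) d

τ : ℕ → ℕ → Poly
τ d m = s d m ⊕ neg (σ d m)

-- geo x y n = Σ_{i<n} x^i y^{n-1-i}, i.e. the polynomial (x^n - y^n)/(x - y)
geo : Poly → Poly → ℕ → Poly
geo x y zero = 𝟘
geo x y (suc n) = pow x n ⊕ y ⊗ geo x y n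

bracket : ℕ → ℕ → Poly
bracket d m =
  pow b+1 d ⊗ κ (+ (d ^ d)) ⊗ pow (s d (m ∸ 1)) (d *ℕ (d ∸ 1))
  ⊕ neg (bd+1 d ⊗ geo (s d m) (σ d m) d)

-- 𝒢 is the defining property  b d · 𝒢_m = bracket_m  for all m ≥ 1
IsCalG : ℕ → (ℕ → Poly) → Set
IsCalG d G = ∀ m → 1 Data.Nat.≤ m → bd d ⊗ G m ≈ bracket d m

prodG : (ℕ → Poly) → ℕ → Poly
prodG G zero = 𝟙
prodG G (suc k) = G (suc k) ⊗ prodG G k

-- Put μₙ = (b+1) d sₙ^(d-1). Then r_{n+1} = μₙ rₙ and σ_{n+1} = μₙ sₙ, the first term of the
-- bracket defining 𝒢_{n+1} is μₙ^d, and since (d-1) - (b+1)d = -(bd+1) we have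
-- τ_{n+1} = rₙ^d - (bd+1) sₙ^d. Multiplying the bracket by τ_{n+1} = s_{n+1} - σ_{n+1} telescopes
-- the geometric sum, and the product collapses to μₙ^d rₙ^d - (bd+1) s_{n+1}^d = τ_{n+2}; the
-- closed form follows from τ₁ = -bd. The bracket is divisible by bd: at b = 0 we have rₙ = sₙ,
-- hence s_{n+1} = σ_{n+1}, and the bracket vanishes; for d ≥ 2 all its coefficients are divisible
-- by d. Finally τₘ ≠ 0, because at b = -1 the factor b+1 kills σₘ and rₘ (m ≥ 1), so
-- τₘ(-1) = sₘ(-1), where s₁(-1) = d and s_{m+1}(-1) = (d-1) sₘ(-1)^d.

module Submission where

open import Algebra using (CommutativeRing)
import Algebra.Properties.CommutativeSemiring.Exp as Exp
open import Data.Integer as ℤ using (ℤ; +_; 0ℤ; 1ℤ; _+_; _*_; -_; _-_; _^_)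
open import Data.Integer.Divisibility.Signed using (_∣_; divides; ∣-refl; ∣m∣n⇒∣m+n; ∣m⇒∣-m; ∣n⇒∣m*n)
import Data.Integer.Properties as ℤP
open import Data.Integer.Tactic.RingSolver using (solve-∀)
open import Data.List using ([]; _∷_)
open import Data.List.Relation.Unary.All using (All; []; _∷_)
open import Data.Maybe using (Maybe; just; nothing)
open import Data.Nat as ℕ using (ℕ; zero; suc; _≤_; _∸_; z≤n; s≤s)
import Data.Nat.Properties as ℕP
open import Data.Product using (Σ; _×_; _,_; proj₁; proj₂)
open import Data.Sum using ([_,_]′)
open import Function using (_∘_)
open import Level using (0ℓ)
open import Relation.Binary.PropositionalEquality
  using (_≡_; _≢_; refl; sym; trans; cong; cong₂; module ≡-Reasoning)
import Relation.Binary.Reasoning.Setoid as SetoidReasoning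
open import Relation.Nullary using (¬_; yes)
open import Tactic.RingSolver using () renaming (solve-∀ to solve-∀-in)
import Tactic.RingSolver.Core.AlmostCommutativeRing as ACR

open import Defs

-- The ring ℤ[b]

coeff : Poly → ℕ → ℤ
coeff [] i = 0ℤ
coeff (a ∷ p) zero = a
coeff (a ∷ p) (suc i) = coeff p i

infix 4 _≋_
record _≋_ (p q : Poly) : Set where
  constructor mk≋
  field at : ∀ i → coeff p i ≡ coeff q i
open _≋_ public

≋-refl : ∀ {p} → p ≋ p
≋-refl = mk≋ λ i → refl

≋-sym : ∀ {p q} → p ≋ q → q ≋ p
≋-sym h = mk≋ λ i → sym (at h i)

≋-trans : ∀ {p q u} → p ≋ q → q ≋ u → p ≋ u
≋-trans h k = mk≋ λ i → trans (at h i) (at k i)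

∷-cong : ∀ {a c p q} → a ≡ c → p ≋ q → a ∷ p ≋ c ∷ q
∷-cong a≡c p≋q = mk≋ λ { zero → a≡c ; (suc i) → at p≋q i }

coeff-⊕ : ∀ p q i → coeff (p ⊕ q) i ≡ coeff p i + coeff q i
coeff-⊕ [] q i = sym (ℤP.+-identityˡ _)
coeff-⊕ (a ∷ p) [] i = sym (ℤP.+-identityʳ _)
coeff-⊕ (a ∷ p) (c ∷ q) zero = refl
coeff-⊕ (a ∷ p) (c ∷ q) (suc i) = coeff-⊕ p q i

coeff-neg : ∀ p i → coeff (neg p) i ≡ - coeff p i
coeff-neg [] i = refl
coeff-neg (a ∷ p) zero = refl
coeff-neg (a ∷ p) (suc i) = coeff-neg p i

coeff-scale : ∀ a p i → coeff (scale a p) i ≡ a * coeff p i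
coeff-scale a [] i = sym (ℤP.*-zeroʳ a)
coeff-scale a (c ∷ p) zero = refl
coeff-scale a (c ∷ p) (suc i) = coeff-scale a p i

⊕-cong : ∀ {p p′ q q′} → p ≋ p′ → q ≋ q′ → p ⊕ q ≋ p′ ⊕ q′
⊕-cong {p} {p′} {q} {q′} h k = mk≋ λ i →
  trans (coeff-⊕ p q i) (trans (cong₂ _+_ (at h i) (at k i)) (sym (coeff-⊕ p′ q′ i)))

neg-cong : ∀ {p q} → p ≋ q → neg p ≋ neg q
neg-cong {p} {q} h = mk≋ λ i →
  trans (coeff-neg p i) (trans (cong -_ (at h i)) (sym (coeff-neg q i)))

scale-cong : ∀ a {p q} → p ≋ q → scale a p ≋ scale a q
scale-cong a {p} {q} h = mk≋ λ i →
  trans (coeff-scale a p i) (trans (cong (a *_) (at h i)) (sym (coeff-scale a q i)))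

⊕-assoc : ∀ p q u → (p ⊕ q) ⊕ u ≋ p ⊕ (q ⊕ u)
⊕-assoc p q u = mk≋ λ i → trans (coeff-⊕ (p ⊕ q) u i)
  (trans (cong (λ z → z + coeff u i) (coeff-⊕ p q i))
  (trans (ℤP.+-assoc (coeff p i) (coeff q i) (coeff u i))
  (trans (cong (λ z → coeff p i + z) (sym (coeff-⊕ q u i))) (sym (coeff-⊕ p (q ⊕ u) i)))))

⊕-comm : ∀ p q → p ⊕ q ≋ q ⊕ p
⊕-comm p q = mk≋ λ i →
  trans (coeff-⊕ p q i) (trans (ℤP.+-comm (coeff p i) _) (sym (coeff-⊕ q p i)))

⊕-identityʳ : ∀ p → p ⊕ 𝟘 ≋ p
⊕-identityʳ p = mk≋ λ i → trans (coeff-⊕ p [] i) (ℤP.+-identityʳ _)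

neg-inverseˡ : ∀ p → neg p ⊕ p ≋ 𝟘
neg-inverseˡ p = mk≋ λ i → trans (coeff-⊕ (neg p) p i)
  (trans (cong (λ z → z + coeff p i) (coeff-neg p i)) (ℤP.+-inverseˡ (coeff p i)))

⊕-interchange : ∀ p q u v → (p ⊕ q) ⊕ (u ⊕ v) ≋ (p ⊕ u) ⊕ (q ⊕ v)
⊕-interchange p q u v = mk≋ λ i →
  trans (coeff-⊕ (p ⊕ q) (u ⊕ v) i) (trans (cong₂ _+_ (coeff-⊕ p q i) (coeff-⊕ u v i))
  (trans (interchange (coeff p i) (coeff q i) (coeff u i) (coeff v i))
  (sym (trans (coeff-⊕ (p ⊕ u) (q ⊕ v) i) (cong₂ _+_ (coeff-⊕ p u i) (coeff-⊕ q v i))))))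
  where
  interchange : ∀ a b c e → (a + b) + (c + e) ≡ (a + c) + (b + e)
  interchange = solve-∀

scale-⊕ : ∀ a p q → scale a (p ⊕ q) ≋ scale a p ⊕ scale a q
scale-⊕ a p q = mk≋ λ i → trans (coeff-scale a (p ⊕ q) i) (trans (cong (a *_) (coeff-⊕ p q i))
  (trans (ℤP.*-distribˡ-+ a (coeff p i) (coeff q i))
  (trans (cong₂ _+_ (sym (coeff-scale a p i)) (sym (coeff-scale a q i)))
  (sym (coeff-⊕ (scale a p) (scale a q) i)))))

scale-zero : ∀ p → scale 0ℤ p ≋ 𝟘
scale-zero p = mk≋ (coeff-scale 0ℤ p)

scale-one : ∀ p → scale 1ℤ p ≋ p
scale-one p = mk≋ λ i → trans (coeff-scale 1ℤ p i) (ℤP.*-identityˡ _)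

scale-scale : ∀ a c p → scale a (scale c p) ≋ scale (a * c) p
scale-scale a c p = mk≋ λ i → trans (coeff-scale a (scale c p) i)
  (trans (cong (a *_) (coeff-scale c p i))
  (trans (sym (ℤP.*-assoc a c (coeff p i))) (sym (coeff-scale (a * c) p i))))

shift : Poly → Poly
shift p = 0ℤ ∷ p

shift-cong : ∀ {p q} → p ≋ q → shift p ≋ shift q
shift-cong = ∷-cong refl

shift-⊕ : ∀ p q → shift (p ⊕ q) ≋ shift p ⊕ shift q
shift-⊕ p q = ∷-cong refl ≋-refl

scale-shift : ∀ a p → scale a (shift p) ≋ shift (scale a p)
scale-shift a p = ∷-cong (ℤP.*-zeroʳ a) ≋-refl

shift-𝟘 : shift 𝟘 ≋ 𝟘
shift-𝟘 = mk≋ λ { zero → refl ; (suc i) → refl }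

⊗-zeroʳ : ∀ p → p ⊗ 𝟘 ≋ 𝟘
⊗-zeroʳ [] = ≋-refl
⊗-zeroʳ (a ∷ p) = ≋-trans (shift-cong (⊗-zeroʳ p)) shift-𝟘

⊗-congʳ : ∀ p {q q′} → q ≋ q′ → p ⊗ q ≋ p ⊗ q′
⊗-congʳ [] h = ≋-refl
⊗-congʳ (a ∷ p) h = ⊕-cong (scale-cong a h) (shift-cong (⊗-congʳ p h))

⊗-∷ : ∀ p c q → p ⊗ (c ∷ q) ≋ scale c p ⊕ shift (p ⊗ q)
⊗-∷ [] c q = ≋-sym shift-𝟘
⊗-∷ (a ∷ p) c q = ∷-cong (cong (λ z → z + 0ℤ) (ℤP.*-comm a c))
  (≋-trans (⊕-cong (≋-refl {scale a q}) (⊗-∷ p c q))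
  (≋-trans (≋-sym (⊕-assoc (scale a q) (scale c p) _))
  (≋-trans (⊕-cong (⊕-comm (scale a q) (scale c p)) ≋-refl) (⊕-assoc (scale c p) (scale a q) _))))

⊗-comm : ∀ p q → p ⊗ q ≋ q ⊗ p
⊗-comm [] q = ≋-sym (⊗-zeroʳ q)
⊗-comm (a ∷ p) q = ≋-trans (⊕-cong ≋-refl (shift-cong (⊗-comm p q))) (≋-sym (⊗-∷ q a p))

⊗-congˡ : ∀ {p p′} q → p ≋ p′ → p ⊗ q ≋ p′ ⊗ q
⊗-congˡ {p} {p′} q h = ≋-trans (⊗-comm p q) (≋-trans (⊗-congʳ q h) (⊗-comm q p′))

⊗-cong : ∀ {p p′ q q′} → p ≋ p′ → q ≋ q′ → p ⊗ q ≋ p′ ⊗ q′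
⊗-cong {p′ = p′} {q = q} h k = ≋-trans (⊗-congˡ q h) (⊗-congʳ p′ k)

⊗-distribˡ-⊕ : ∀ p q u → p ⊗ (q ⊕ u) ≋ p ⊗ q ⊕ p ⊗ u
⊗-distribˡ-⊕ [] q u = ≋-refl
⊗-distribˡ-⊕ (a ∷ p) q u =
  ≋-trans (⊕-cong (scale-⊕ a q u)
                  (≋-trans (shift-cong (⊗-distribˡ-⊕ p q u)) (shift-⊕ (p ⊗ q) (p ⊗ u))))
          (⊕-interchange (scale a q) (scale a u) (shift (p ⊗ q)) (shift (p ⊗ u)))

⊗-distribʳ-⊕ : ∀ p q u → (q ⊕ u) ⊗ p ≋ q ⊗ p ⊕ u ⊗ p
⊗-distribʳ-⊕ p q u = ≋-trans (⊗-comm (q ⊕ u) p)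
  (≋-trans (⊗-distribˡ-⊕ p q u) (⊕-cong (⊗-comm p q) (⊗-comm p u)))

scale-⊗ : ∀ a q u → scale a q ⊗ u ≋ scale a (q ⊗ u)
scale-⊗ a [] u = ≋-refl
scale-⊗ a (c ∷ q) u =
  ≋-trans (⊕-cong (≋-sym (scale-scale a c u))
                  (≋-trans (shift-cong (scale-⊗ a q u)) (≋-sym (scale-shift a (q ⊗ u)))))
          (≋-sym (scale-⊕ a (scale c u) (shift (q ⊗ u))))

⊗-assoc : ∀ p q u → (p ⊗ q) ⊗ u ≋ p ⊗ (q ⊗ u)
⊗-assoc [] q u = ≋-refl
⊗-assoc (a ∷ p) q u = ≋-trans (⊗-distribʳ-⊕ u (scale a q) (shift (p ⊗ q)))
  (⊕-cong (scale-⊗ a q u) (⊕-cong (scale-zero u) (shift-cong (⊗-assoc p q u))))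

⊗-identityˡ : ∀ p → 𝟙 ⊗ p ≋ p
⊗-identityˡ p = ≋-trans (⊕-cong (scale-one p) shift-𝟘) (⊕-identityʳ p)

⊗-identityʳ : ∀ p → p ⊗ 𝟙 ≋ p
⊗-identityʳ p = ≋-trans (⊗-comm p 𝟙) (⊗-identityˡ p)

ℤ[b] : CommutativeRing 0ℓ 0ℓ
ℤ[b] = record
  { Carrier = Poly ; _≈_ = _≋_ ; _+_ = _⊕_ ; _*_ = _⊗_ ; -_ = neg ; 0# = 𝟘 ; 1# = 𝟙
  ; isCommutativeRing = record
    { isRing = record
      { +-isAbelianGroup = record
        { isGroup = record
          { isMonoid = record
            { isSemigroup = record
              { isMagma = record
                { isEquivalence = record { refl = ≋-refl ; sym = ≋-sym ; trans = ≋-trans }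
                ; ∙-cong = ⊕-cong }
              ; assoc = ⊕-assoc }
            ; identity = (λ p → ≋-refl) , ⊕-identityʳ }
          ; inverse = neg-inverseˡ , λ p → ≋-trans (⊕-comm p (neg p)) (neg-inverseˡ p)
          ; ⁻¹-cong = neg-cong }
        ; comm = ⊕-comm }
      ; *-cong = ⊗-cong
      ; *-assoc = ⊗-assoc
      ; *-identity = ⊗-identityˡ , ⊗-identityʳ
      ; distrib = ⊗-distribˡ-⊕ , ⊗-distribʳ-⊕ }
    ; *-comm = ⊗-comm } }

ℤ[b]-almost : ACR.AlmostCommutativeRing 0ℓ 0ℓ
ℤ[b]-almost = ACR.fromCommutativeRing ℤ[b] zero?
  where
  -- Without a zero test the solver's normal forms keep vanishing terms and fail to agree by refl.
  zero? : ∀ p → Maybe (𝟘 ≋ p)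
  zero? [] = just ≋-refl
  zero? (a ∷ p) with a ℤ.≟ 0ℤ | zero? p
  ... | yes refl | just h = just (≋-trans (≋-sym shift-𝟘) (shift-cong h))
  ... | _ | _ = nothing

module ≋-Reasoning = SetoidReasoning (CommutativeRing.setoid ℤ[b])

⊖≋𝟘⇒≋ : ∀ {p q} → p ⊕ neg q ≋ 𝟘 → p ≋ q
⊖≋𝟘⇒≋ {p} {q} h = ≋-trans (cancel p q) (⊕-cong h ≋-refl)
  where
  cancel : ∀ p q → p ≋ (p ⊕ neg q) ⊕ q
  cancel = solve-∀-in ℤ[b]-almost

≋⇒⊖≋𝟘 : ∀ {p q} → p ≋ q → p ⊕ neg q ≋ 𝟘
≋⇒⊖≋𝟘 {q = q} h = ≋-trans (⊕-cong h ≋-refl) (≋-trans (⊕-comm q (neg q)) (neg-inverseˡ q))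

All≡0⇒≋𝟘 : ∀ {p} → All (_≡ 0ℤ) p → p ≋ 𝟘
All≡0⇒≋𝟘 [] = ≋-refl
All≡0⇒≋𝟘 (a≡0 ∷ h) = ≋-trans (∷-cong a≡0 (All≡0⇒≋𝟘 h)) shift-𝟘

≋𝟘⇒All≡0 : ∀ p → p ≋ 𝟘 → All (_≡ 0ℤ) p
≋𝟘⇒All≡0 [] h = []
≋𝟘⇒All≡0 (a ∷ p) h = at h 0 ∷ ≋𝟘⇒All≡0 p (mk≋ (at h ∘ suc))

≈⇒≋ : ∀ {p q} → p ≈ q → p ≋ q
≈⇒≋ h = ⊖≋𝟘⇒≋ (All≡0⇒≋𝟘 h)

≋⇒≈ : ∀ {p q} → p ≋ q → p ≈ q
≋⇒≈ h = ≋𝟘⇒All≡0 _ (≋⇒⊖≋𝟘 h)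

module Pow = Exp (CommutativeRing.commutativeSemiring ℤ[b])

pow≡^ : ∀ x n → pow x n ≡ x Pow.^ n
pow≡^ x zero = refl
pow≡^ x (suc n) = cong (x ⊗_) (pow≡^ x n)

pow-cong : ∀ n {x y} → x ≋ y → pow x n ≋ pow y n
pow-cong n {x} {y} h rewrite pow≡^ x n | pow≡^ y n = Pow.^-congˡ n h

pow-distrib-⊗ : ∀ x y n → pow (x ⊗ y) n ≋ pow x n ⊗ pow y n
pow-distrib-⊗ x y n rewrite pow≡^ (x ⊗ y) n | pow≡^ x n | pow≡^ y n = Pow.^-distrib-* x y n

pow-pow : ∀ x m n → pow (pow x m) n ≋ pow x (m ℕ.* n)
pow-pow x m n rewrite pow≡^ (pow x m) n | pow≡^ x m | pow≡^ x (m ℕ.* n) = Pow.^-assocʳ x m n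

pow-𝟙 : ∀ n → pow 𝟙 n ≋ 𝟙
pow-𝟙 zero = ≋-refl
pow-𝟙 (suc n) = ≋-trans (⊗-identityˡ (pow 𝟙 n)) (pow-𝟙 n)

κ-⊗ : ∀ a c → κ a ⊗ κ c ≋ κ (a * c)
κ-⊗ a c = ∷-cong (ℤP.+-identityʳ _) ≋-refl

pow-κ : ∀ m n → pow (κ (+ m)) n ≋ κ (+ (m ℕ.^ n))
pow-κ m zero = ≋-refl
pow-κ m (suc n) = ≋-trans (⊗-congʳ (κ (+ m)) (pow-κ m n))
  (≋-trans (κ-⊗ (+ m) (+ (m ℕ.^ n))) (∷-cong (sym (ℤP.pos-* m (m ℕ.^ n))) ≋-refl))

geo-telescope : ∀ x y n → geo x y n ⊗ (x ⊕ neg y) ≋ pow x n ⊕ neg (pow y n)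
geo-telescope x y zero = ≋-sym (≋⇒⊖≋𝟘 (≋-refl {𝟙}))
geo-telescope x y (suc n) = begin
  (pow x n ⊕ y ⊗ geo x y n) ⊗ (x ⊕ neg y)
    ≈⟨ expand (pow x n) (geo x y n) x y ⟩
  x ⊗ pow x n ⊕ neg (y ⊗ pow x n) ⊕ y ⊗ (geo x y n ⊗ (x ⊕ neg y))
    ≈⟨ ⊕-cong ≋-refl (⊗-congʳ y (geo-telescope x y n)) ⟩
  x ⊗ pow x n ⊕ neg (y ⊗ pow x n) ⊕ y ⊗ (pow x n ⊕ neg (pow y n))
    ≈⟨ collapse (pow x n) (pow y n) x y ⟩
  x ⊗ pow x n ⊕ neg (y ⊗ pow y n) ∎
  where
  open ≋-Reasoning
  expand : ∀ u g x y → (u ⊕ y ⊗ g) ⊗ (x ⊕ neg y) ≋ x ⊗ u ⊕ neg (y ⊗ u) ⊕ y ⊗ (g ⊗ (x ⊕ neg y))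
  expand = solve-∀-in ℤ[b]-almost
  collapse : ∀ u v x y → x ⊗ u ⊕ neg (y ⊗ u) ⊕ y ⊗ (u ⊕ neg v) ≋ x ⊗ u ⊕ neg (y ⊗ v)
  collapse = solve-∀-in ℤ[b]-almost

-- Evaluation

ev : ℤ → Poly → ℤ
ev x [] = 0ℤ
ev x (a ∷ p) = a + x * ev x p

ev-⊕ : ∀ x p q → ev x (p ⊕ q) ≡ ev x p + ev x q
ev-⊕ x [] q = sym (ℤP.+-identityˡ _)
ev-⊕ x (a ∷ p) [] = sym (ℤP.+-identityʳ _)
ev-⊕ x (a ∷ p) (c ∷ q) = trans (cong (λ z → (a + c) + x * z) (ev-⊕ x p q)) (regroup a c x (ev x p) (ev x q))
  where
  regroup : ∀ a c x u v → (a + c) + x * (u + v) ≡ (a + x * u) + (c + x * v)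
  regroup = solve-∀

ev-scale : ∀ x a p → ev x (scale a p) ≡ a * ev x p
ev-scale x a [] = sym (ℤP.*-zeroʳ a)
ev-scale x a (c ∷ p) = trans (cong (λ z → a * c + x * z) (ev-scale x a p)) (regroup a c x (ev x p))
  where
  regroup : ∀ a c x u → a * c + x * (a * u) ≡ a * (c + x * u)
  regroup = solve-∀

ev-⊗ : ∀ x p q → ev x (p ⊗ q) ≡ ev x p * ev x q
ev-⊗ x [] q = refl
ev-⊗ x (a ∷ p) q = trans (ev-⊕ x (scale a q) (shift (p ⊗ q)))
  (trans (cong₂ _+_ (ev-scale x a q) (cong (λ z → 0ℤ + x * z) (ev-⊗ x p q))) (regroup x a (ev x p) (ev x q)))
  where
  regroup : ∀ x a u v → a * v + (0ℤ + x * (u * v)) ≡ (a + x * u) * v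
  regroup = solve-∀

ev-neg : ∀ x p → ev x (neg p) ≡ - ev x p
ev-neg x [] = refl
ev-neg x (a ∷ p) = trans (cong (λ z → - a + x * z) (ev-neg x p)) (regroup x a (ev x p))
  where
  regroup : ∀ x a u → - a + x * - u ≡ - (a + x * u)
  regroup = solve-∀

ev-⊖ : ∀ x p q → ev x (p ⊕ neg q) ≡ ev x p - ev x q
ev-⊖ x p q = trans (ev-⊕ x p (neg q)) (cong (λ z → ev x p + z) (ev-neg x q))

ev-κ : ∀ x a → ev x (κ a) ≡ a
ev-κ x a = trans (cong (λ z → a + z) (ℤP.*-zeroʳ x)) (ℤP.+-identityʳ a)

ev-pow : ∀ x p n → ev x (pow p n) ≡ ev x p ^ n
ev-pow x p zero = ev-κ x 1ℤ
ev-pow x p (suc n) = trans (ev-⊗ x p (pow p n)) (cong (ev x p *_) (ev-pow x p n))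

ev-≋𝟘 : ∀ x {p} → p ≋ 𝟘 → ev x p ≡ 0ℤ
ev-≋𝟘 x {[]} h = refl
ev-≋𝟘 x {a ∷ p} h = trans (cong₂ (λ u v → u + x * v) (at h 0) (ev-≋𝟘 x {p} (mk≋ (at h ∘ suc))))
  (cong (λ z → 0ℤ + z) (ℤP.*-zeroʳ x))

ev-cong : ∀ x {p q} → p ≋ q → ev x p ≡ ev x q
ev-cong x {p} {q} h = ℤP.i-j≡0⇒i≡j _ _ (trans (sym (ev-⊖ x p q)) (ev-≋𝟘 x (≋⇒⊖≋𝟘 h)))

ev-geo-diagonal : ∀ x {p q y} n → ev x p ≡ y → ev x q ≡ y → ev x (geo p q (suc n)) ≡ + suc n * y ^ n
ev-geo-diagonal x {p} {q} {y} zero p≡y q≡y =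
  trans (ev-⊕ x 𝟙 (q ⊗ 𝟘)) (cong₂ _+_ (ev-κ x 1ℤ) (trans (ev-⊗ x q 𝟘) (ℤP.*-zeroʳ (ev x q))))
ev-geo-diagonal x {p} {q} {y} (suc n) p≡y q≡y = begin
  ev x (pow p (suc n) ⊕ q ⊗ geo p q (suc n))
    ≡⟨ ev-⊕ x (pow p (suc n)) (q ⊗ geo p q (suc n)) ⟩
  ev x (pow p (suc n)) + ev x (q ⊗ geo p q (suc n))
    ≡⟨ cong₂ _+_ (trans (ev-pow x p (suc n)) (cong (_^ suc n) p≡y))
                   (trans (ev-⊗ x q (geo p q (suc n))) (cong₂ _*_ q≡y (ev-geo-diagonal x {p} {q} n p≡y q≡y))) ⟩
  y * y ^ n + y * (+ suc n * y ^ n)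
    ≡⟨ count y (y ^ n) (+ suc n) ⟩
  + suc (suc n) * y ^ suc n ∎
  where
  open ≡-Reasoning
  count : ∀ y t e → y * t + y * (e * t) ≡ (1ℤ + e) * (y * t)
  count = solve-∀

-- Divisibility of all coefficients

infix 4 _∣ₚ_
_∣ₚ_ : ℤ → Poly → Set
k ∣ₚ p = ∀ i → k ∣ coeff p i

∣ₚ-respʳ-≋ : ∀ {k p q} → p ≋ q → k ∣ₚ p → k ∣ₚ q
∣ₚ-respʳ-≋ p≋q k∣p i rewrite sym (at p≋q i) = k∣p i

∣ₚ-⊕ : ∀ {k} p q → k ∣ₚ p → k ∣ₚ q → k ∣ₚ p ⊕ q
∣ₚ-⊕ p q k∣p k∣q i rewrite coeff-⊕ p q i = ∣m∣n⇒∣m+n (k∣p i) (k∣q i)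

∣ₚ-neg : ∀ {k} p → k ∣ₚ p → k ∣ₚ neg p
∣ₚ-neg p k∣p i rewrite coeff-neg p i = ∣m⇒∣-m (k∣p i)

∣ₚ-⊗ʳ : ∀ {k} p q → k ∣ₚ q → k ∣ₚ p ⊗ q
∣ₚ-⊗ʳ [] q k∣q i = divides 0ℤ refl
∣ₚ-⊗ʳ (a ∷ p) q k∣q = ∣ₚ-⊕ (scale a q) (shift (p ⊗ q)) k∣aq k∣shift
  where
  k∣aq : _ ∣ₚ scale a q
  k∣aq i rewrite coeff-scale a q i = ∣n⇒∣m*n a (k∣q i)
  k∣shift : _ ∣ₚ shift (p ⊗ q)
  k∣shift zero = divides 0ℤ refl
  k∣shift (suc i) = ∣ₚ-⊗ʳ p q k∣q i

∣ₚ-⊗ˡ : ∀ {k} p q → k ∣ₚ p → k ∣ₚ p ⊗ q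
∣ₚ-⊗ˡ p q k∣p = ∣ₚ-respʳ-≋ (⊗-comm q p) (∣ₚ-⊗ʳ q p k∣p)

∣ₚ-κ-refl : ∀ k → k ∣ₚ κ k
∣ₚ-κ-refl k zero = ∣-refl
∣ₚ-κ-refl k (suc i) = divides 0ℤ refl

∣ₚ-pow-suc : ∀ {k} x n → k ∣ₚ x → k ∣ₚ pow x (suc n)
∣ₚ-pow-suc x n = ∣ₚ-⊗ˡ x (pow x n)

∣ₚ-geo : ∀ {k} x y n → k ∣ₚ x → k ∣ₚ y → k ∣ₚ geo x y (suc (suc n))
∣ₚ-geo x y n k∣x k∣y = ∣ₚ-⊕ (pow x (suc n)) (y ⊗ geo x y (suc n))
  (∣ₚ-pow-suc x n k∣x) (∣ₚ-⊗ˡ y (geo x y (suc n)) k∣y)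

∣ₚ⇒scale : ∀ {k} p → k ∣ₚ p → Σ Poly λ q → scale k q ≋ p
∣ₚ⇒scale [] k∣p = [] , ≋-refl
∣ₚ⇒scale {k} (a ∷ p) k∣p with ∣ₚ⇒scale p (k∣p ∘ suc) | k∣p 0
... | q , kq≋p | divides c a≡ck = c ∷ q , ∷-cong (sym (trans a≡ck (ℤP.*-comm c k))) kq≋p

bd⊗≋shift-scale : ∀ d q → bd d ⊗ q ≋ shift (scale (+ d) q)
bd⊗≋shift-scale d q = ⊕-cong (scale-zero q) (shift-cong (≋-trans (⊕-cong ≋-refl shift-𝟘) (⊕-identityʳ _)))

bd-quotient : ∀ d p → ev 0ℤ p ≡ 0ℤ → + d ∣ₚ p → Σ Poly λ q → bd d ⊗ q ≋ p
bd-quotient d [] _ _ = 𝟘 , ⊗-zeroʳ (bd d)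
bd-quotient d (a ∷ p) p₀≡0 d∣p with ∣ₚ⇒scale p (d∣p ∘ suc)
... | q , dq≋p = q , ≋-trans (bd⊗≋shift-scale d q) (∷-cong (sym a≡0) dq≋p)
  where
  a≡0 : a ≡ 0ℤ
  a≡0 = trans (sym (ℤP.+-identityʳ a)) p₀≡0

-- The recurrence for τ (d ≥ 1)

module Recurrence (d′ : ℕ) where

  d : ℕ
  d = suc d′

  μ : ℕ → Poly
  μ n = b+1 ⊗ κ (+ d) ⊗ pow (s d n) d′

  -- bracket d (suc n) unfolds to bracketHead n ⊕ neg (bd+1 d ⊗ geo (s d (suc n)) (σ d (suc n)) d).
  bracketHead : ℕ → Poly
  bracketHead n = pow b+1 d ⊗ κ (+ (d ℕ.^ d)) ⊗ pow (s d n) (d ℕ.* d′)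

  r-suc : ∀ n → r d (suc n) ≋ μ n ⊗ r d n
  r-suc n = swap b+1 (κ (+ d)) (r d n) (pow (s d n) d′)
    where
    swap : ∀ a c x y → a ⊗ c ⊗ x ⊗ y ≋ a ⊗ c ⊗ y ⊗ x
    swap = solve-∀-in ℤ[b]-almost

  σ-suc : ∀ n → σ d (suc n) ≋ μ n ⊗ s d n
  σ-suc n = swap b+1 (κ (+ d)) (s d n) (pow (s d n) d′)
    where
    swap : ∀ a c x y → a ⊗ c ⊗ (x ⊗ y) ≋ a ⊗ c ⊗ y ⊗ x
    swap = solve-∀-in ℤ[b]-almost

  bracketHead≋μ^d : ∀ n → bracketHead n ≋ pow (μ n) d
  bracketHead≋μ^d n = ≋-sym (begin
    pow (b+1 ⊗ κ (+ d) ⊗ pow S d′) d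
      ≈⟨ pow-distrib-⊗ (b+1 ⊗ κ (+ d)) (pow S d′) d ⟩
    pow (b+1 ⊗ κ (+ d)) d ⊗ pow (pow S d′) d
      ≈⟨ ⊗-cong (≋-trans (pow-distrib-⊗ b+1 (κ (+ d)) d) (⊗-congʳ (pow b+1 d) (pow-κ d d))) (pow-pow S d′ d) ⟩
    pow b+1 d ⊗ κ (+ (d ℕ.^ d)) ⊗ pow S (d′ ℕ.* d)
      ≡⟨ cong (λ k → pow b+1 d ⊗ κ (+ (d ℕ.^ d)) ⊗ pow S k) (ℕP.*-comm d′ d) ⟩
    bracketHead n ∎)
    where
    open ≋-Reasoning
    S = s d n

  pow-μ⊗ : ∀ n x → pow (μ n ⊗ x) d ≋ bracketHead n ⊗ pow x d
  pow-μ⊗ n x = ≋-trans (pow-distrib-⊗ (μ n) x d) (⊗-congˡ (pow x d) (≋-sym (bracketHead≋μ^d n)))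

  bracketHead≋[b+1]d⊗σ^d′ : ∀ n → bracketHead n ≋ b+1 ⊗ κ (+ d) ⊗ pow (σ d (suc n)) d′
  bracketHead≋[b+1]d⊗σ^d′ n = begin
    bracketHead n
      ≈⟨ bracketHead≋μ^d n ⟩
    μ n ⊗ pow (μ n) d′
      ≈⟨ regroup b+1 (κ (+ d)) (pow S d′) (pow (μ n) d′) ⟩
    b+1 ⊗ κ (+ d) ⊗ (pow (μ n) d′ ⊗ pow S d′)
      ≈⟨ ⊗-congʳ (b+1 ⊗ κ (+ d)) (≋-sym (pow-distrib-⊗ (μ n) S d′)) ⟩
    b+1 ⊗ κ (+ d) ⊗ pow (μ n ⊗ S) d′
      ≈⟨ ⊗-congʳ (b+1 ⊗ κ (+ d)) (pow-cong d′ (≋-sym (σ-suc n))) ⟩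
    b+1 ⊗ κ (+ d) ⊗ pow (σ d (suc n)) d′ ∎
    where
    open ≋-Reasoning
    S = s d n
    regroup : ∀ a c x y → a ⊗ c ⊗ x ⊗ y ≋ a ⊗ c ⊗ (y ⊗ x)
    regroup = solve-∀-in ℤ[b]-almost

  d′-[b+1]d≋-[bd+1] : κ (+ d′) ⊕ neg (b+1 ⊗ κ (+ d)) ≋ neg (bd+1 d)
  d′-[b+1]d≋-[bd+1] = mk≋ λ { zero → constant (+ d′) ; (suc zero) → linear (+ d′) ; (suc (suc i)) → refl }
    where
    constant : ∀ e → e + - (1ℤ * (1ℤ + e) + 0ℤ) ≡ - 1ℤ
    constant = solve-∀
    linear : ∀ e → - (1ℤ * (1ℤ + e) + 0ℤ) ≡ - (1ℤ + e)
    linear = solve-∀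

  τ-suc : ∀ n → τ d (suc n) ≋ pow (r d n) d ⊕ neg (bd+1 d ⊗ pow (s d n) d)
  τ-suc n = begin
    (pow R d ⊕ κ (+ d′) ⊗ pow S d) ⊕ neg (b+1 ⊗ κ (+ d) ⊗ pow S d)
      ≈⟨ regroup (pow R d) (pow S d) (κ (+ d′)) (b+1 ⊗ κ (+ d)) ⟩
    pow R d ⊕ (κ (+ d′) ⊕ neg (b+1 ⊗ κ (+ d))) ⊗ pow S d
      ≈⟨ ⊕-cong (≋-refl {pow R d}) (⊗-congˡ (pow S d) d′-[b+1]d≋-[bd+1]) ⟩
    pow R d ⊕ neg (bd+1 d) ⊗ pow S d
      ≈⟨ ⊕-cong (≋-refl {pow R d}) (neg-⊗ (bd+1 d) (pow S d)) ⟩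
    pow R d ⊕ neg (bd+1 d ⊗ pow S d) ∎
    where
    open ≋-Reasoning
    R = r d n
    S = s d n
    regroup : ∀ x y c e → (x ⊕ c ⊗ y) ⊕ neg (e ⊗ y) ≋ x ⊕ (c ⊕ neg e) ⊗ y
    regroup = solve-∀-in ℤ[b]-almost
    neg-⊗ : ∀ x y → neg x ⊗ y ≋ neg (x ⊗ y)
    neg-⊗ = solve-∀-in ℤ[b]-almost

  τ-one : τ d 1 ≋ neg (bd d)
  τ-one = begin
    τ d 1                                  ≈⟨ τ-suc 0 ⟩
    pow 𝟙 d ⊕ neg ((𝟙 ⊕ bd d) ⊗ pow 𝟙 d)   ≈⟨ ⊕-cong (pow-𝟙 d) (neg-cong (⊗-congʳ (𝟙 ⊕ bd d) (pow-𝟙 d))) ⟩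
    𝟙 ⊕ neg ((𝟙 ⊕ bd d) ⊗ 𝟙)               ≈⟨ cancel (bd d) ⟩
    neg (bd d)                             ∎
    where
    open ≋-Reasoning
    cancel : ∀ x → 𝟙 ⊕ neg ((𝟙 ⊕ x) ⊗ 𝟙) ≋ neg x
    cancel = solve-∀-in ℤ[b]-almost

  τ-suc-suc : ∀ n → τ d (suc (suc n)) ≋ bracket d (suc n) ⊗ τ d (suc n)
  τ-suc-suc n = begin
    τ d (suc (suc n))
      ≈⟨ τ-suc (suc n) ⟩
    pow (r d (suc n)) d ⊕ neg (M ⊗ X)
      ≈⟨ ⊕-cong (≋-trans (pow-cong d (r-suc n)) (pow-μ⊗ n (r d n))) ≋-refl ⟩
    A ⊗ pow (r d n) d ⊕ neg (M ⊗ X)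
      ≈⟨ expand A (pow (r d n) d) (pow (s d n) d) M X ⟩
    A ⊗ (pow (r d n) d ⊕ neg (M ⊗ pow (s d n) d)) ⊕ neg (M ⊗ (X ⊕ neg (A ⊗ pow (s d n) d)))
      ≈⟨ ⊕-cong (⊗-congʳ A (≋-sym (τ-suc n))) (neg-cong (⊗-congʳ M (≋-sym geo⊗τ))) ⟩
    A ⊗ τ d (suc n) ⊕ neg (M ⊗ (g ⊗ τ d (suc n)))
      ≈⟨ factor A M g (τ d (suc n)) ⟩
    (A ⊕ neg (M ⊗ g)) ⊗ τ d (suc n) ∎
    where
    open ≋-Reasoning
    A = bracketHead n
    M = bd+1 d
    X = pow (s d (suc n)) d
    g = geo (s d (suc n)) (σ d (suc n)) d
    geo⊗τ : g ⊗ τ d (suc n) ≋ X ⊕ neg (A ⊗ pow (s d n) d)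
    geo⊗τ = ≋-trans (geo-telescope (s d (suc n)) (σ d (suc n)) d)
      (⊕-cong ≋-refl (neg-cong (≋-trans (pow-cong d (σ-suc n)) (pow-μ⊗ n (s d n)))))
    expand : ∀ a x y m z → a ⊗ x ⊕ neg (m ⊗ z) ≋ a ⊗ (x ⊕ neg (m ⊗ y)) ⊕ neg (m ⊗ (z ⊕ neg (a ⊗ y)))
    expand = solve-∀-in ℤ[b]-almost
    factor : ∀ a m g t → a ⊗ t ⊕ neg (m ⊗ (g ⊗ t)) ≋ (a ⊕ neg (m ⊗ g)) ⊗ t
    factor = solve-∀-in ℤ[b]-almost

  ev₀-bd+1⊗ : ∀ p → ev 0ℤ (bd+1 d ⊗ p) ≡ ev 0ℤ p
  ev₀-bd+1⊗ p = trans (ev-⊗ 0ℤ (bd+1 d) p) (ℤP.*-identityˡ (ev 0ℤ p))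

  ev₀-[b+1]d⊗ : ∀ p → ev 0ℤ (b+1 ⊗ κ (+ d) ⊗ p) ≡ + d * ev 0ℤ p
  ev₀-[b+1]d⊗ p = trans (ev-⊗ 0ℤ (b+1 ⊗ κ (+ d)) p)
    (cong (_* ev 0ℤ p) (trans (ev-⊗ 0ℤ b+1 (κ (+ d))) (trans (ℤP.*-identityˡ _) (ev-κ 0ℤ (+ d)))))

  ev₀-τ-suc : ∀ n → ev 0ℤ (r d n) ≡ ev 0ℤ (s d n) → ev 0ℤ (τ d (suc n)) ≡ 0ℤ
  ev₀-τ-suc n r≡s = begin
    ev 0ℤ (τ d (suc n))
      ≡⟨ ev-cong 0ℤ (τ-suc n) ⟩
    ev 0ℤ (pow (r d n) d ⊕ neg (bd+1 d ⊗ pow (s d n) d))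
      ≡⟨ ev-⊖ 0ℤ (pow (r d n) d) _ ⟩
    ev 0ℤ (pow (r d n) d) - ev 0ℤ (bd+1 d ⊗ pow (s d n) d)
      ≡⟨ cong₂ _-_ (ev-pow 0ℤ (r d n) d) (trans (ev₀-bd+1⊗ (pow (s d n) d)) (ev-pow 0ℤ (s d n) d)) ⟩
    ev 0ℤ (r d n) ^ d - ev 0ℤ (s d n) ^ d
      ≡⟨ cong (λ y → y ^ d - ev 0ℤ (s d n) ^ d) r≡s ⟩
    ev 0ℤ (s d n) ^ d - ev 0ℤ (s d n) ^ d
      ≡⟨ ℤP.+-inverseʳ (ev 0ℤ (s d n) ^ d) ⟩
    0ℤ ∎
    where open ≡-Reasoning

  ev₀-s≡σ : ∀ n → ev 0ℤ (r d n) ≡ ev 0ℤ (s d n) → ev 0ℤ (s d (suc n)) ≡ ev 0ℤ (σ d (suc n))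
  ev₀-s≡σ n r≡s =
    ℤP.i-j≡0⇒i≡j _ _ (trans (sym (ev-⊖ 0ℤ (s d (suc n)) (σ d (suc n)))) (ev₀-τ-suc n r≡s))

  ev₀-r≡s : ∀ n → ev 0ℤ (r d n) ≡ ev 0ℤ (s d n)
  ev₀-r≡s zero = refl
  ev₀-r≡s (suc n) = begin
    ev 0ℤ (r d (suc n))          ≡⟨ ev-cong 0ℤ (r-suc n) ⟩
    ev 0ℤ (μ n ⊗ r d n)          ≡⟨ ev-⊗ 0ℤ (μ n) (r d n) ⟩
    ev 0ℤ (μ n) * ev 0ℤ (r d n)  ≡⟨ cong (ev 0ℤ (μ n) *_) (ev₀-r≡s n) ⟩
    ev 0ℤ (μ n) * ev 0ℤ (s d n)  ≡⟨ sym (ev-⊗ 0ℤ (μ n) (s d n)) ⟩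
    ev 0ℤ (μ n ⊗ s d n)          ≡⟨ ev-cong 0ℤ (≋-sym (σ-suc n)) ⟩
    ev 0ℤ (σ d (suc n))          ≡⟨ sym (ev₀-s≡σ n (ev₀-r≡s n)) ⟩
    ev 0ℤ (s d (suc n))          ∎
    where open ≡-Reasoning

  ev₀-bracket : ∀ n → ev 0ℤ (bracket d (suc n)) ≡ 0ℤ
  ev₀-bracket n = begin
    ev 0ℤ (bracketHead n ⊕ neg (bd+1 d ⊗ g))    ≡⟨ ev-⊖ 0ℤ (bracketHead n) (bd+1 d ⊗ g) ⟩
    ev 0ℤ (bracketHead n) - ev 0ℤ (bd+1 d ⊗ g)  ≡⟨ cong₂ _-_ ev₀-head (trans (ev₀-bd+1⊗ g) ev₀-g) ⟩
    + d * Y ^ d′ - + d * Y ^ d′                 ≡⟨ ℤP.+-inverseʳ (+ d * Y ^ d′) ⟩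
    0ℤ                                          ∎
    where
    open ≡-Reasoning
    g = geo (s d (suc n)) (σ d (suc n)) d
    Y = ev 0ℤ (σ d (suc n))
    ev₀-head : ev 0ℤ (bracketHead n) ≡ + d * Y ^ d′
    ev₀-head = trans (ev-cong 0ℤ (bracketHead≋[b+1]d⊗σ^d′ n))
      (trans (ev₀-[b+1]d⊗ (pow (σ d (suc n)) d′)) (cong (+ d *_) (ev-pow 0ℤ (σ d (suc n)) d′)))
    ev₀-g : ev 0ℤ g ≡ + d * Y ^ d′
    ev₀-g = ev-geo-diagonal 0ℤ {s d (suc n)} {σ d (suc n)} d′ (ev₀-s≡σ n (ev₀-r≡s n)) refl

  s-one : s d 1 ≋ κ (+ d)
  s-one = ⊕-cong {q′ = κ (+ d′)} (pow-𝟙 d)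
    (≋-trans (⊗-congʳ (κ (+ d′)) (pow-𝟙 d)) (⊗-identityʳ (κ (+ d′))))

  ev-s-suc : ∀ x n → ev x (s d (suc n)) ≡ ev x (r d n) ^ d + + d′ * ev x (s d n) ^ d
  ev-s-suc x n = trans (ev-⊕ x (pow (r d n) d) (κ (+ d′) ⊗ pow (s d n) d))
    (cong₂ _+_ (ev-pow x (r d n) d)
      (trans (ev-⊗ x (κ (+ d′)) (pow (s d n) d)) (cong₂ _*_ (ev-κ x (+ d′)) (ev-pow x (s d n) d))))

  module _ (G : ℕ → Poly) (G-spec : IsCalG d G) where

    τ-recurrence : ∀ n → τ d (suc (suc n)) ≋ bd d ⊗ G (suc n) ⊗ τ d (suc n)
    τ-recurrence n = ≋-trans (τ-suc-suc n) (⊗-congˡ (τ d (suc n)) (≋-sym G-quotient))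
      where
      G-quotient : bd d ⊗ G (suc n) ≋ bracket d (suc n)
      G-quotient = ≈⇒≋ {bd d ⊗ G (suc n)} {bracket d (suc n)} (G-spec (suc n) (s≤s z≤n))

    τ-closed-form : ∀ k → τ d (suc k) ≋ neg (pow (bd d) (suc k) ⊗ prodG G k)
    τ-closed-form zero = ≋-trans τ-one (pad (bd d))
      where
      pad : ∀ x → neg x ≋ neg ((x ⊗ 𝟙) ⊗ 𝟙)
      pad = solve-∀-in ℤ[b]-almost
    τ-closed-form (suc k) = ≋-trans (τ-recurrence k)
      (≋-trans (⊗-congʳ (bd d ⊗ G (suc k)) (τ-closed-form k))
               (regroup (bd d) (G (suc k)) (pow (bd d) (suc k)) (prodG G k)))
      where
      regroup : ∀ x g p q → (x ⊗ g) ⊗ neg (p ⊗ q) ≋ neg ((x ⊗ p) ⊗ (g ⊗ q))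
      regroup = solve-∀-in ℤ[b]-almost

-- Existence of 𝒢 and non-vanishing of τ (d ≥ 2)

module _ (d″ : ℕ) where
  open Recurrence (suc d″)

  ∣ₚ-[b+1]d⊗ : ∀ p → + d ∣ₚ b+1 ⊗ κ (+ d) ⊗ p
  ∣ₚ-[b+1]d⊗ p = ∣ₚ-⊗ˡ (b+1 ⊗ κ (+ d)) p (∣ₚ-⊗ʳ b+1 (κ (+ d)) (∣ₚ-κ-refl (+ d)))

  ∣ₚ-s-suc : ∀ n → + d ∣ₚ s d (suc n)
  ∣ₚ-s-suc zero = ∣ₚ-respʳ-≋ (≋-sym s-one) (∣ₚ-κ-refl (+ d))
  ∣ₚ-s-suc (suc n) = ∣ₚ-⊕ (pow (r d (suc n)) d) (κ (+ suc d″) ⊗ pow (s d (suc n)) d)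
    (∣ₚ-pow-suc (r d (suc n)) (suc d″)
      (∣ₚ-⊗ˡ (b+1 ⊗ κ (+ d) ⊗ r d n) (pow (s d n) (suc d″)) (∣ₚ-[b+1]d⊗ (r d n))))
    (∣ₚ-⊗ʳ (κ (+ suc d″)) (pow (s d (suc n)) d) (∣ₚ-pow-suc (s d (suc n)) (suc d″) (∣ₚ-s-suc n)))

  ∣ₚ-bracket : ∀ n → + d ∣ₚ bracket d (suc n)
  ∣ₚ-bracket n = ∣ₚ-⊕ (bracketHead n) (neg (bd+1 d ⊗ g))
    (∣ₚ-respʳ-≋ (≋-sym (bracketHead≋[b+1]d⊗σ^d′ n)) (∣ₚ-[b+1]d⊗ (pow (σ d (suc n)) (suc d″))))
    (∣ₚ-neg (bd+1 d ⊗ g) (∣ₚ-⊗ʳ (bd+1 d) g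
      (∣ₚ-geo (s d (suc n)) (σ d (suc n)) d″ (∣ₚ-s-suc n) (∣ₚ-[b+1]d⊗ (pow (s d n) d)))))
    where
    g = geo (s d (suc n)) (σ d (suc n)) d

  bracket-quotient : ∀ n → Σ Poly λ q → bd d ⊗ q ≋ bracket d (suc n)
  bracket-quotient n = bd-quotient d (bracket d (suc n)) (ev₀-bracket n) (∣ₚ-bracket n)

  𝒢 : ℕ → Poly
  𝒢 zero = 𝟘
  𝒢 (suc n) = proj₁ (bracket-quotient n)

  𝒢-spec : IsCalG d 𝒢
  𝒢-spec (suc n) _ = ≋⇒≈ (proj₂ (bracket-quotient n))

  -- ev (- 1ℤ) b+1 computes to 0ℤ, and 0ℤ * x reduces to 0ℤ.
  ev₋₁-[b+1]d⊗ : ∀ p → ev (- 1ℤ) (b+1 ⊗ κ (+ d) ⊗ p) ≡ 0ℤ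
  ev₋₁-[b+1]d⊗ p =
    trans (ev-⊗ (- 1ℤ) (b+1 ⊗ κ (+ d)) p) (cong (_* ev (- 1ℤ) p) (ev-⊗ (- 1ℤ) b+1 (κ (+ d))))

  ev₋₁-r-suc : ∀ n → ev (- 1ℤ) (r d (suc n)) ≡ 0ℤ
  ev₋₁-r-suc n = trans (ev-⊗ (- 1ℤ) (b+1 ⊗ κ (+ d) ⊗ r d n) (pow (s d n) (suc d″)))
    (cong (_* ev (- 1ℤ) (pow (s d n) (suc d″))) (ev₋₁-[b+1]d⊗ (r d n)))

  ev₋₁-s-suc≢0 : ∀ n → ev (- 1ℤ) (s d (suc n)) ≢ 0ℤ
  ev₋₁-s-suc≢0 zero s₁≡0 with trans (sym (trans (ev-cong (- 1ℤ) s-one) (ev-κ (- 1ℤ) (+ d)))) s₁≡0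
  ... | ()
  ev₋₁-s-suc≢0 (suc n) s₂₊ₙ≡0 =
    [ (λ ()) , ev₋₁-s-suc≢0 n ∘ ℤP.i^n≡0⇒i≡0 _ d ]′ (ℤP.i*j≡0⇒i≡0∨j≡0 (+ suc d″) d′s₁₊ₙᵈ≡0)
    where
    open ≡-Reasoning
    S = ev (- 1ℤ) (s d (suc n))
    d′s₁₊ₙᵈ≡0 : + suc d″ * S ^ d ≡ 0ℤ
    d′s₁₊ₙᵈ≡0 = begin
      + suc d″ * S ^ d                               ≡⟨ sym (ℤP.+-identityˡ _) ⟩
      0ℤ ^ d + + suc d″ * S ^ d                      ≡⟨ cong (λ z → z ^ d + + suc d″ * S ^ d) (sym (ev₋₁-r-suc n)) ⟩
      ev (- 1ℤ) (r d (suc n)) ^ d + + suc d″ * S ^ d ≡⟨ sym (ev-s-suc (- 1ℤ) (suc n)) ⟩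
      ev (- 1ℤ) (s d (suc (suc n)))                  ≡⟨ s₂₊ₙ≡0 ⟩
      0ℤ                                             ∎

  τ-suc≉𝟘 : ∀ n → ¬ τ d (suc n) ≈ 𝟘
  τ-suc≉𝟘 n τ≈𝟘 = ev₋₁-s-suc≢0 n (begin
    ev (- 1ℤ) (s d (suc n))                            ≡⟨ sym (ℤP.+-identityʳ _) ⟩
    ev (- 1ℤ) (s d (suc n)) - 0ℤ                       ≡⟨ cong (λ z → ev (- 1ℤ) (s d (suc n)) - z)
                                                               (sym (ev₋₁-[b+1]d⊗ (pow (s d n) d))) ⟩
    ev (- 1ℤ) (s d (suc n)) - ev (- 1ℤ) (σ d (suc n))  ≡⟨ sym (ev-⊖ (- 1ℤ) (s d (suc n)) (σ d (suc n))) ⟩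
    ev (- 1ℤ) (τ d (suc n))                            ≡⟨ ev-cong (- 1ℤ) (≈⇒≋ {τ d (suc n)} {𝟘} τ≈𝟘) ⟩
    0ℤ                                                 ∎)
    where open ≡-Reasoning

proposition4p3 : (d : ℕ) → 2 ≤ d →
    Σ (ℕ → Poly) (λ G → IsCalG d G)
    × ((G : ℕ → Poly) → IsCalG d G →
        (∀ m → 2 ≤ m → (¬ (τ d (m ∸ 1) ≈ 𝟘)) × (τ d m ≈ bd d ⊗ G (m ∸ 1) ⊗ τ d (m ∸ 1)))
        × (∀ m → 1 ≤ m → τ d m ≈ neg (pow (bd d) m ⊗ prodG G (m ∸ 1))))
proposition4p3 (suc (suc d″)) (s≤s (s≤s z≤n)) = (𝒢 d″ , 𝒢-spec d″) , λ G G-spec →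
    (λ { (suc zero) (s≤s ())
       ; (suc (suc n)) _ → τ-suc≉𝟘 d″ n , ≋⇒≈ (τ-recurrence G G-spec n) })
  , (λ { (suc k) _ → ≋⇒≈ (τ-closed-form G G-spec k) })
  where open Recurrence (suc d″)
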